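{- Let $n$ be a positive integer. Every Latin square $L$ of order $n$ contains a critical set of size less than $n^2 - n\frac{\sqrt{n\pi}}{2}$.
   Context: A Latin square of order $n$ is an $n\times n$ array with entries from $X=\{1,\dots,n\}$ in which each element of $X$ occurs exactly once in each row and exactly once in each column; it is identified with the set of triples $(i,j;k)$ such that symbol $k$ occurs in cell $(i,j)$. A partial Latin square of order $n$ is an $n\times n$ array, some cells possibly empty, with entries from $X$ such that each element occurs at most once in each row and at most once in each column (again viewed as a set of triples); its size is the number of filled cells. A partial Latin square $C$ contained in a Latin square $L$ is uniquely completable if $L$ is the only Latin square of order $n$ containing $C$ (i.e., having $k$ in cell $(i,j)$ for every $(i,j;k)\in C$). A critical set in $L$ is a partial Latin square $C\subseteq L$ that is uniquely completable and such that no proper subset of $C$ is uniquely completable. -}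

module Defs where

open import Data.Nat using (ℕ; zero; suc; _+_; _*_; _∸_; _^_; _<_)
open import Data.Nat.Properties using ()
open import Data.Integer as ℤ using (ℤ; +_; -[1+_])
open import Data.Rational.Unnormalised as Q using (ℚᵘ; mkℚᵘ)
open import Data.Fin using (Fin)
open import Data.List using (List; map; allFin)
open import Data.Nat.ListAction using (sum)
open import Data.Bool using (Bool; true; false; if_then_else_)
open import Data.Product using (Σ; ∃; _×_; _,_)
open import Relation.Binary.PropositionalEquality using (_≡_)
open import Relation.Nullary using (¬_)

Square : ℕ → Set
Square n = Fin n → Fin n → Fin n

IsLatin : {n : ℕ} → Square n → Set
IsLatin {n} L =
  ((i k : Fin n) → Σ (Fin n) λ j → (L i j ≡ k) × ((j' : Fin n) → L i j' ≡ k → j' ≡ j)) ×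
  ((j k : Fin n) → Σ (Fin n) λ i → (L i j ≡ k) × ((i' : Fin n) → L i' j ≡ k → i' ≡ i))

-- A partial Latin square contained in L (a subset of the triples of L)
-- is determined by its set of filled cells: C i j ≡ true means the
-- triple (i , j ; L i j) belongs to it.
SubOf : ℕ → Set
SubOf n = Fin n → Fin n → Bool

size : {n : ℕ} → SubOf n → ℕ
size {n} C = sum (map (λ i → sum (map (λ j → if C i j then 1 else 0) (allFin n))) (allFin n))

UniquelyCompletable : {n : ℕ} → Square n → SubOf n → Set
UniquelyCompletable {n} L C =
  (L' : Square n) → IsLatin L' →
  ((i j : Fin n) → C i j ≡ true → L' i j ≡ L i j) →
  (i j : Fin n) → L' i j ≡ L i j

ProperSub : {n : ℕ} → SubOf n → SubOf n → Set
ProperSub {n} C' C =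
  ((i j : Fin n) → C' i j ≡ true → C i j ≡ true) ×
  Σ (Fin n) λ i → Σ (Fin n) λ j → (C i j ≡ true) × (C' i j ≡ false)

IsCritical : {n : ℕ} → Square n → SubOf n → Set
IsCritical {n} L C =
  UniquelyCompletable L C ×
  ((C' : SubOf n) → ProperSub C' C → ¬ UniquelyCompletable L C')

-- π via Leibniz series π = 4 Σ_k (-1)^k/(2k+1).  The partial sums with
-- an odd number of terms, 4 Σ_{k=0}^{2m} (-1)^k/(2k+1), strictly
-- decrease to π, so for a rational x:  π < x  ⇔  ∃ m, upper m < x.

leibnizTerm : ℕ → ℚᵘ
leibnizTerm k = mkℚᵘ (sgn k) (2 * k)
  where
  sgn : ℕ → ℤ
  sgn zero = + 1
  sgn (suc zero) = -[1+ 0 ]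
  sgn (suc (suc k)) = sgn k

leibnizSum : ℕ → ℚᵘ
leibnizSum zero = Q.0ℚᵘ
leibnizSum (suc t) = leibnizSum t Q.+ leibnizTerm t

leibnizUpper : ℕ → ℚᵘ
leibnizUpper m = mkℚᵘ (+ 4) 0 Q.* leibnizSum (suc (2 * m))

PiTimesLt : ℕ → ℕ → Set
PiTimesLt q p = ∃ λ m → (leibnizUpper m Q.* mkℚᵘ (+ q) 0) Q.< mkℚᵘ (+ p) 0

-- s < n² − n·√(nπ)/2, for n ≥ 1 and natural s; equivalently
-- s < n² and n³·π < 4·(n² − s)².
SmallSize : ℕ → ℕ → Set
SmallSize n s = (s < n ^ 2) × PiTimesLt (n ^ 3) (4 * ((n ^ 2 ∸ s) ^ 2))

module Submission where

-- Call a list S of cells forcing when no cell (i , j) of S has, among the later cells of S,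
-- a cell (i , c) in its row and a cell (r , j) in its column with L i c = L r j.  If a Latin
-- square L′ agrees with L outside a forcing list, it also agrees at its head (i , j): in L
-- the symbol L′ i j occurs once in row i and once in column j; an occurrence outside the
-- list is, by Latinness of L′, at (i , j) itself, and the two cannot both lie later in the
-- list.  Hence the complement of a forcing list is uniquely completable, and it contains a
-- critical set, found by deleting cells while unique completability (decidable by
-- exhaustive search) survives.
--
-- A forcing list is built row by row.  The cells that row i may contribute are the
-- independent lists of a digraph on the columns with one arc per cell already chosen, and
-- repeatedly taking a vertex of minimum outdegree and discarding its out-neighbours gives
-- at least n²/(n + m) of them, m the current length (a Turán-type bound).  So m² + 2nm grows
-- by 2n² per row and ends at least 2n³, whence 4m² > (52/15) n³ > π n³, while the critical
-- set has at most n² − m cells.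

open import Defs
open import Data.Bool using (Bool; true; false; if_then_else_; not; _∧_)
import Data.Bool as Bool
open import Data.Fin using (Fin; zero; suc)
open import Data.Fin.Properties using (_≟_; suc-injective; any?; all?)
import Data.Integer as ℤ
import Data.Integer.Properties as ℤ-Properties
open import Data.List using (List; []; _∷_; map; length; tabulate; allFin; filter; _++_; cartesianProduct)
import Data.List.Membership.DecPropositional as DecMembership
open import Data.List.Membership.Propositional using (_∈_; _∉_)
open import Data.List.Membership.Propositional.Properties using (∈-map⁺; ∈-map⁻; ∈-++⁻; ∈-filter⁺; ∈-allFin; ∈-cartesianProduct⁺)
open import Data.List.Properties using (map-tabulate; length-map; length-++; length-tabulate)
open import Data.List.Relation.Unary.All as All using (All; []; _∷_)
import Data.List.Relation.Unary.All.Properties as All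
open import Data.List.Relation.Unary.AllPairs using (AllPairs; []; _∷_)
open import Data.List.Relation.Unary.Any using (here; there)
open import Data.List.Relation.Unary.Unique.Propositional using (Unique)
import Data.List.Relation.Unary.Unique.Propositional.Properties as Unique
open import Data.Nat using (ℕ; zero; suc; _+_; _*_; _^_; _∸_; _≤_; _<_; z≤n; s≤s; z<s; _≡ᵇ_)
open import Data.Nat.Induction using (<-wellFounded)
import Data.Nat.ListAction as List
open import Data.Nat.Properties using (+-*-semiring; ≤-totalOrder; ≤-refl; ≤-reflexive; ≤-trans; ≤-total; <-≤-trans; ≰⇒>; <⇒≱; ≮⇒≥; ≤ᵇ⇒≤; m≤m+n; m≤n+m; m<m+n; m≤n⇒∃[o]m+o≡n; m+n≤o⇒m≤o∸n; 1+n≢0; +-comm; +-assoc; +-identityʳ; *-comm; *-identityˡ; *-identityʳ; *-zeroʳ; *-suc; *-distribˡ-+; +-mono-≤; +-monoˡ-≤; +-monoʳ-≤; +-mono-<; *-mono-≤; *-monoˡ-≤; *-monoʳ-≤; *-mono-<; *-monoˡ-<; *-monoʳ-<; *-cancelˡ-≤; module ≤-Reasoning)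
open import Algebra.Properties.Semiring.Sum +-*-semiring using (sum; sum-syntax; sum-cong-≗; sum-replicate-zero; ∑-distrib-+; *-distribʳ-sum)
open import Data.List.Extrema ≤-totalOrder using (argmin; argmin-all; f[argmin]≤f[xs])
open import Data.Nat.Tactic.RingSolver using (solve-∀)
open import Data.Product using (Σ; ∃; _×_; _,_; proj₁; proj₂; uncurry)
open import Data.Product.Properties using (≡-dec)
open import Data.Rational.Unnormalised using (*<*)
open import Data.Sum using (_⊎_; inj₁; inj₂)
open import Data.Unit using (tt)
open import Data.Vec using (Vec; []; _∷_; lookup)
import Data.Vec as Vec
open import Data.Vec.Properties using (lookup∘tabulate)
open import Function using (_∘_; id; const)
open import Induction.WellFounded using (Acc; acc)
open import Relation.Binary.Definitions using (DecidableEquality)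
open import Relation.Binary.PropositionalEquality
open import Relation.Nullary using (¬_; Dec; does; yes; no; contradiction)
open import Relation.Nullary.Decidable using (dec-true; dec-false; map′; _×-dec_; _→-dec_)
open import Relation.Unary using (Decidable)

𝟙 : Bool → ℕ
𝟙 b = if b then 1 else 0

𝟙≤1 : ∀ b → 𝟙 b ≤ 1
𝟙≤1 true  = ≤-refl
𝟙≤1 false = z≤n

sum-mono-≤ : ∀ {n} {f g : Fin n → ℕ} → (∀ i → f i ≤ g i) → sum f ≤ sum g
sum-mono-≤ {zero}  f≤g = z≤n
sum-mono-≤ {suc n} f≤g = +-mono-≤ (f≤g zero) (sum-mono-≤ (f≤g ∘ suc))

sum-zero : ∀ {n} {f : Fin n → ℕ} → (∀ i → f i ≡ 0) → sum f ≡ 0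
sum-zero {n} f≡0 = trans (sum-cong-≗ f≡0) (sum-replicate-zero n)

sum-single : ∀ {n} {f : Fin n → ℕ} p → (∀ i → i ≢ p → f i ≡ 0) → sum f ≡ f p
sum-single {suc n} {f} zero    f≡0 = trans (cong (f zero +_) (sum-zero (λ i → f≡0 (suc i) λ ()))) (+-identityʳ _)
sum-single {suc n} {f} (suc p) f≡0 =
  cong₂ _+_ (f≡0 zero λ ()) (sum-single p (λ i i≢p → f≡0 (suc i) (i≢p ∘ suc-injective)))

sum-const : ∀ n c → ∑[ i < n ] c ≡ n * c
sum-const zero    c = refl
sum-const (suc n) c = cong (c +_) (sum-const n c)

listSum-tabulate : ∀ {n} (f : Fin n → ℕ) → List.sum (tabulate f) ≡ sum f
listSum-tabulate {zero}  f = refl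
listSum-tabulate {suc n} f = cong (f zero +_) (listSum-tabulate (f ∘ suc))

listSum-allFin : ∀ {n} (f : Fin n → ℕ) → List.sum (map f (allFin n)) ≡ sum f
listSum-allFin f = trans (cong List.sum (map-tabulate id f)) (listSum-tabulate f)

size≡∑ : ∀ {n} (C : SubOf n) → size C ≡ ∑[ i < n ] ∑[ j < n ] 𝟙 (C i j)
size≡∑ {n} C = trans (listSum-allFin (λ i → List.sum (map (λ j → 𝟙 (C i j)) (allFin n))))
                     (sum-cong-≗ (λ i → listSum-allFin (λ j → 𝟙 (C i j))))

∑⟨_⟩ : ∀ {n} → (Fin n → Bool) → (Fin n → ℕ) → ℕ
∑⟨_⟩ {n} V f = ∑[ u < n ] (𝟙 (V u) * f u)

∑⟨⟩-mono : ∀ {n} (V : Fin n → Bool) {f g} → (∀ u → V u ≡ true → f u ≤ g u) → ∑⟨ V ⟩ f ≤ ∑⟨ V ⟩ g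
∑⟨⟩-mono V {f} {g} f≤g = sum-mono-≤ pointwise
  where
  pointwise : ∀ u → 𝟙 (V u) * f u ≤ 𝟙 (V u) * g u
  pointwise u with V u in Vu
  ... | true  = *-monoʳ-≤ 1 (f≤g u Vu)
  ... | false = z≤n

∑⟨⟩-⊆ : ∀ {n} {U V : Fin n → Bool} f → (∀ u → U u ≡ true → V u ≡ true) → ∑⟨ U ⟩ f ≤ ∑⟨ V ⟩ f
∑⟨⟩-⊆ {U = U} {V} f U⊆V = sum-mono-≤ pointwise
  where
  pointwise : ∀ u → 𝟙 (U u) * f u ≤ 𝟙 (V u) * f u
  pointwise u with U u in Uu
  ... | true  rewrite U⊆V u Uu = ≤-refl
  ... | false = z≤n

∑⟨⟩-split : ∀ {n} (V B : Fin n → Bool) f →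
            ∑⟨ V ⟩ f ≡ ∑⟨ (λ u → V u ∧ B u) ⟩ f + ∑⟨ (λ u → V u ∧ not (B u)) ⟩ f
∑⟨⟩-split V B f = trans (sum-cong-≗ (λ u → pointwise (V u) (B u) (f u)))
  (∑-distrib-+ (λ u → 𝟙 (V u ∧ B u) * f u) (λ u → 𝟙 (V u ∧ not (B u)) * f u))
  where
  pointwise : ∀ a b x → 𝟙 a * x ≡ 𝟙 (a ∧ b) * x + 𝟙 (a ∧ not b) * x
  pointwise true  true  x = sym (+-identityʳ _)
  pointwise true  false x = refl
  pointwise false b     x = refl

∑⟨⟩-distrib-+ : ∀ {n} (V : Fin n → Bool) f g → ∑⟨ V ⟩ (λ u → f u + g u) ≡ ∑⟨ V ⟩ f + ∑⟨ V ⟩ g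
∑⟨⟩-distrib-+ V f g = trans (sum-cong-≗ (λ u → *-distribˡ-+ (𝟙 (V u)) (f u) (g u)))
  (∑-distrib-+ (λ u → 𝟙 (V u) * f u) (λ u → 𝟙 (V u) * g u))

∑⟨⟩-const : ∀ {n} (V : Fin n → Bool) c → ∑⟨ V ⟩ (const c) ≡ ∑⟨ V ⟩ (const 1) * c
∑⟨⟩-const V c = trans (sum-cong-≗ (λ u → cong (_* c) (sym (*-identityʳ (𝟙 (V u))))))
                      (sym (*-distribʳ-sum c (λ u → 𝟙 (V u) * 1)))

∑⟨⟩-δ : ∀ {n} (V : Fin n → Bool) v → ∑⟨ V ⟩ (λ u → 𝟙 (does (u ≟ v))) ≡ 𝟙 (V v)
∑⟨⟩-δ V v = trans (sum-single v (λ u u≢v → trans (cong (λ b → 𝟙 (V u) * 𝟙 b) (dec-false (u ≟ v) u≢v))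
                                                 (*-zeroʳ (𝟙 (V u)))))
                  (trans (cong (λ b → 𝟙 (V v) * 𝟙 b) (dec-true (v ≟ v) refl)) (*-identityʳ (𝟙 (V v))))

2xy≤x²+y²-ordered : ∀ {x y} → x ≤ y → 2 * x * y ≤ x * x + y * y
2xy≤x²+y²-ordered {x} x≤y with m≤n⇒∃[o]m+o≡n x≤y
... | t , refl = ≤-trans (m≤m+n _ (t * t)) (≤-reflexive (square x t))
  where
  square : ∀ x t → 2 * x * (x + t) + t * t ≡ x * x + (x + t) * (x + t)
  square = solve-∀

2xy≤x²+y² : ∀ x y → 2 * x * y ≤ x * x + y * y
2xy≤x²+y² x y with ≤-total x y
... | inj₁ x≤y = 2xy≤x²+y²-ordered x≤y
... | inj₂ y≤x = subst₂ _≤_ (swap y x) (+-comm (y * y) (x * x)) (2xy≤x²+y²-ordered y≤x)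
  where
  swap : ∀ y x → 2 * y * x ≡ 2 * x * y
  swap = solve-∀

-- Cauchy–Schwarz in the form (x + k)² ≤ (a + 1)(x²/a + k²), cleared of denominators.
turán-step : ∀ {x k T} a → k * k ≤ T → x * x + a * (k * k) ≤ a * T → (x + k) * (x + k) ≤ suc a * T
turán-step {zero}  zero k²≤T _ = ≤-trans k²≤T (≤-reflexive (sym (+-identityʳ _)))
turán-step {suc _} zero _ ()
turán-step {x} {k} {T} a@(suc _) _ h = *-cancelˡ-≤ a (begin
  a * ((x + k) * (x + k))               ≡⟨ expand a x k ⟩
  (a * (x * x) + a * (k * k)) + 2 * x * (a * k) ≤⟨ +-monoʳ-≤ _ (2xy≤x²+y² x (a * k)) ⟩
  (a * (x * x) + a * (k * k)) + (x * x + (a * k) * (a * k)) ≡⟨ regroup a x k ⟩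
  suc a * (x * x + a * (k * k))          ≤⟨ *-monoʳ-≤ (suc a) h ⟩
  suc a * (a * T)                        ≡⟨ *-comm-middle a T ⟩
  a * (suc a * T)                        ∎)
  where
  open ≤-Reasoning
  expand : ∀ a x k → a * ((x + k) * (x + k)) ≡ (a * (x * x) + a * (k * k)) + 2 * x * (a * k)
  expand = solve-∀
  regroup : ∀ a x k → (a * (x * x) + a * (k * k)) + (x * x + (a * k) * (a * k)) ≡ suc a * (x * x + a * (k * k))
  regroup = solve-∀
  *-comm-middle : ∀ a T → suc a * (a * T) ≡ a * (suc a * T)
  *-comm-middle = solve-∀

turán-invariant : ∀ {x k d E E′} a → k ≤ suc d → (x + k) * d ≤ E → E′ + k * d ≤ E →
                  x * x ≤ a * (x + E′) → (x + k) * (x + k) ≤ suc a * ((x + k) + E)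
turán-invariant {x} {k} {d} {E} {E′} a k≤1+d xd≤E E′+kd≤E ih = turán-step {x} {k} a k²≤T x²+ak²≤aT
  where
  open ≤-Reasoning
  k²≤k+kd : k * k ≤ k + k * d
  k²≤k+kd = ≤-trans (*-monoʳ-≤ k k≤1+d) (≤-reflexive (*-suc k d))
  k²≤T : k * k ≤ (x + k) + E
  k²≤T = begin
    k * k                ≤⟨ k²≤k+kd ⟩
    k + k * d            ≤⟨ +-mono-≤ (m≤n+m k x) (≤-trans (*-monoˡ-≤ d (m≤n+m k x)) xd≤E) ⟩
    (x + k) + E          ∎
  x+E′+k²≤T : x + E′ + k * k ≤ (x + k) + E
  x+E′+k²≤T = begin
    x + E′ + k * k        ≤⟨ +-monoʳ-≤ (x + E′) k²≤k+kd ⟩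
    x + E′ + (k + k * d)  ≡⟨ regroup x E′ k (k * d) ⟩
    (x + k) + (E′ + k * d) ≤⟨ +-monoʳ-≤ (x + k) E′+kd≤E ⟩
    (x + k) + E          ∎
    where
    regroup : ∀ x E′ k kd → x + E′ + (k + kd) ≡ (x + k) + (E′ + kd)
    regroup = solve-∀
  x²+ak²≤aT : x * x + a * (k * k) ≤ a * ((x + k) + E)
  x²+ak²≤aT = begin
    x * x + a * (k * k)         ≤⟨ +-monoˡ-≤ (a * (k * k)) ih ⟩
    a * (x + E′) + a * (k * k)  ≡⟨ *-distribˡ-+ a (x + E′) (k * k) ⟨
    a * (x + E′ + k * k)        ≤⟨ *-monoʳ-≤ a x+E′+k²≤T ⟩
    a * ((x + k) + E)           ∎

-- (m + n)² − n², kept free of subtraction.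
potential : ℕ → ℕ → ℕ
potential n m = m * m + 2 * n * m

growth-step : ∀ {n m a} → n * n ≤ a * (n + m) → potential n m + 2 * (n * n) ≤ potential n (m + a)
growth-step {n} {m} {a} h = begin
  m * m + 2 * n * m + 2 * (n * n)           ≤⟨ +-monoʳ-≤ (m * m + 2 * n * m) (*-monoʳ-≤ 2 h) ⟩
  m * m + 2 * n * m + 2 * (a * (n + m))     ≤⟨ m≤m+n _ (a * a) ⟩
  m * m + 2 * n * m + 2 * (a * (n + m)) + a * a ≡⟨ expand n m a ⟩
  (m + a) * (m + a) + 2 * n * (m + a)       ∎
  where
  open ≤-Reasoning
  expand : ∀ n m a → m * m + 2 * n * m + 2 * (a * (n + m)) + a * a ≡ (m + a) * (m + a) + 2 * n * (m + a)
  expand = solve-∀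

potential-mono-≤ : ∀ n {m t} → m ≤ t → potential n m ≤ potential n t
potential-mono-≤ n m≤t = +-mono-≤ (*-mono-≤ m≤t m≤t) (*-monoʳ-≤ (2 * n) m≤t)

13n³<15m²-via : ∀ n {m} t → potential n t < n * (2 * (n * n)) → 13 * (n * n * n) < 15 * (suc t * suc t) →
                n * (2 * (n * n)) ≤ potential n m → 13 * (n * n * n) < 15 * (m * m)
13n³<15m²-via n {m} t pt<2n³ 13n³<15[t+1]² 2n³≤pm = <-≤-trans 13n³<15[t+1]² (*-monoʳ-≤ 15 (*-mono-≤ t<m t<m))
  where
  t<m : t < m
  t<m = ≰⇒> (λ m≤t → <⇒≱ pt<2n³ (≤-trans 2n³≤pm (potential-mono-≤ n m≤t)))

2n≤m-large : ∀ {n m} → 4 ≤ n → n * (2 * (n * n)) ≤ potential n m → 2 * n ≤ m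
2n≤m-large {n@(suc _)} {m} 4≤n 2n³≤pm = ≮⇒≥ λ m<2n → <⇒≱ (pm<2n³ m<2n) 2n³≤pm
  where
  open ≤-Reasoning
  pm<2n³ : m < 2 * n → potential n m < n * (2 * (n * n))
  pm<2n³ m<2n = begin-strict
    m * m + 2 * n * m                  <⟨ +-mono-< (*-mono-< m<2n m<2n) (*-monoʳ-< (2 * n) m<2n) ⟩
    2 * n * (2 * n) + 2 * n * (2 * n)  ≡⟨ eightfold n ⟩
    4 * (2 * (n * n))                  ≤⟨ *-monoˡ-≤ (2 * (n * n)) 4≤n ⟩
    n * (2 * (n * n))                  ∎
    where
    eightfold : ∀ n → 2 * n * (2 * n) + 2 * n * (2 * n) ≡ 4 * (2 * (n * n))
    eightfold = solve-∀

13n³<15m²-large : ∀ {n m} → 4 ≤ n → n * (2 * (n * n)) ≤ potential n m → 13 * (n * n * n) < 15 * (m * m)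
13n³<15m²-large {n@(suc _)} {m} 4≤n 2n³≤pm = begin-strict
  13 * (n * n * n)  <⟨ *-monoˡ-< (n * n * n) {13} {15} (≤ᵇ⇒≤ 14 15 tt) ⟩
  15 * (n * n * n)  ≤⟨ *-monoʳ-≤ 15 n³≤m² ⟩
  15 * (m * m)      ∎
  where
  open ≤-Reasoning
  n³≤m² : n * n * n ≤ m * m
  n³≤m² = *-cancelˡ-≤ 2 (begin
    2 * (n * n * n)    ≡⟨ rotate n ⟩
    n * (2 * (n * n))  ≤⟨ 2n³≤pm ⟩
    m * m + 2 * n * m  ≤⟨ +-monoʳ-≤ (m * m) (*-monoˡ-≤ m (2n≤m-large {n} {m} 4≤n 2n³≤pm)) ⟩
    m * m + m * m      ≡⟨ cong (m * m +_) (+-identityʳ (m * m)) ⟨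
    2 * (m * m)        ∎)
    where
    rotate : ∀ n → 2 * (n * n * n) ≡ n * (2 * (n * n))
    rotate = solve-∀

-- For n ≥ 4 the hypothesis forces m ≥ 2n, hence m² ≥ n³; for n ≤ 3 it forces m > t for the t given.
13n³<15m² : ∀ n {m} → 0 < n → n * (2 * (n * n)) ≤ potential n m → 13 * (n * n * n) < 15 * (m * m)
13n³<15m² 1 {m} _ = 13n³<15m²-via 1 {m} 0 (≤ᵇ⇒≤ _ _ tt) (≤ᵇ⇒≤ _ _ tt)
13n³<15m² 2 {m} _ = 13n³<15m²-via 2 {m} 2 (≤ᵇ⇒≤ _ _ tt) (≤ᵇ⇒≤ _ _ tt)
13n³<15m² 3 {m} _ = 13n³<15m²-via 3 {m} 4 (≤ᵇ⇒≤ _ _ tt) (≤ᵇ⇒≤ _ _ tt)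
13n³<15m² (suc (suc (suc (suc _)))) {m} _ = 13n³<15m²-large {m = m} (s≤s (s≤s (s≤s (s≤s z≤n))))

-- leibnizUpper 1 = 4 (1 − 1/3 + 1/5) computes to the fraction 52/15.
piTimesLt : ∀ q p → 52 * q < 15 * p → PiTimesLt q p
piTimesLt q p 52q<15p = 1 , *<* (subst₂ ℤ._<_ lhs rhs (ℤ.+<+ 52q<15p))
  where
  open ℤ using (+_)
  lhs : + (52 * q) ≡ (+ 52 ℤ.* + q) ℤ.* + 1
  lhs = trans (ℤ-Properties.pos-* 52 q) (sym (ℤ-Properties.*-identityʳ _))
  rhs : + (15 * p) ≡ + p ℤ.* + 15
  rhs = trans (cong +_ (*-comm 15 p)) (ℤ-Properties.pos-* p 15)

smallSize : ∀ {n s m} → 13 * (n * n * n) < 15 * (m * m) → s + m ≤ n * n → SmallSize n s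
smallSize {n} {s} {m@(suc _)} 13n³<15m² s+m≤n² = s<n² , piTimesLt (n ^ 3) (4 * ((n ^ 2 ∸ s) ^ 2)) 52n³<60X²
  where
  open ≤-Reasoning
  n^2≡n*n : n ^ 2 ≡ n * n
  n^2≡n*n = cong (n *_) (*-identityʳ n)
  s<n² : s < n ^ 2
  s<n² = begin-strict
    s      <⟨ m<m+n s z<s ⟩
    s + m  ≤⟨ s+m≤n² ⟩
    n * n  ≡⟨ n^2≡n*n ⟨
    n ^ 2  ∎
  X = n ^ 2 ∸ s
  m≤X : m ≤ X
  m≤X = m+n≤o⇒m≤o∸n m (subst (m + s ≤_) (sym n^2≡n*n) (≤-trans (≤-reflexive (+-comm m s)) s+m≤n²))
  52n³<60X² : 52 * n ^ 3 < 15 * (4 * X ^ 2)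
  52n³<60X² = begin-strict
    52 * n ^ 3           ≡⟨ cube n ⟩
    4 * (13 * (n * n * n)) <⟨ *-monoʳ-< 4 13n³<15m² ⟩
    4 * (15 * (m * m))    ≤⟨ *-monoʳ-≤ 4 (*-monoʳ-≤ 15 (*-mono-≤ m≤X m≤X)) ⟩
    4 * (15 * (X * X))    ≡⟨ square X ⟩
    15 * (4 * X ^ 2)     ∎
    where
    cube : ∀ n → 52 * (n * (n * (n * 1))) ≡ 4 * (13 * (n * n * n))
    cube = solve-∀
    square : ∀ X → 4 * (15 * (X * X)) ≡ 15 * (4 * (X * (X * 1)))
    square = solve-∀

argmin-on : ∀ {n} (f : Fin n → ℕ) (V : Fin n → Bool) {v} → V v ≡ true →
            ∃ λ u → V u ≡ true × (∀ w → V w ≡ true → f u ≤ f w)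
argmin-on {n} f V {v} Vv = u , argmin-all f Vv (All.all-filter ∈V? (allFin n)) , minimal
  where
  ∈V? = λ w → V w Bool.≟ true
  candidates = filter ∈V? (allFin n)
  u = argmin f v candidates
  minimal : ∀ w → V w ≡ true → f u ≤ f w
  minimal w Vw = All.lookup (f[argmin]≤f[xs] v candidates) (∈-filter⁺ ∈V? (∈-allFin w) Vw)

-- Greedy independent lists in a digraph

module Digraph {n : ℕ} (ε : Fin n → Fin n → ℕ) where

  Vertices : Set
  Vertices = Fin n → Bool

  card : Vertices → ℕ
  card V = ∑⟨ V ⟩ (const 1)

  outdeg : Vertices → Fin n → ℕ
  outdeg V u = ∑⟨ V ⟩ (ε u)

  arcs : Vertices → ℕ
  arcs V = ∑⟨ V ⟩ (outdeg V)

  Independent : List (Fin n) → Set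
  Independent = AllPairs (λ v w → v ≢ w × ε v w ≡ 0)

  record IndependentList (V : Vertices) : Set where
    field
      vertices    : List (Fin n)
      ⊆V          : All (λ v → V v ≡ true) vertices
      independent : Independent vertices
      turán       : card V * card V ≤ length vertices * (card V + arcs V)

  module GreedyStep (V : Vertices) (u : Fin n) (Vu : V u ≡ true)
                    (minimal : ∀ w → V w ≡ true → outdeg V u ≤ outdeg V w) where

    survives : Vertices
    survives w = not (does (w ≟ u)) ∧ (ε u w ≡ᵇ 0)

    V′ X : Vertices
    V′ w = V w ∧ survives w
    X  w = V w ∧ not (survives w)

    d = outdeg V u

    V′⊆V : ∀ w → V′ w ≡ true → V w ≡ true
    V′⊆V w V′w with V w
    ... | true = refl

    X⊆V : ∀ w → X w ≡ true → V w ≡ true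
    X⊆V w Xw with V w
    ... | true = refl

    card-split : card V ≡ card V′ + card X
    card-split = ∑⟨⟩-split V survives (const 1)

    survivor-independent : ∀ w → V′ w ≡ true → u ≢ w × ε u w ≡ 0
    survivor-independent w V′w with V w | w ≟ u | ε u w
    ... | true | no w≢u | zero = w≢u ∘ sym , refl

    removed-cost : ∀ w → X w ≡ true → 1 ≤ 𝟙 (does (w ≟ u)) + ε u w
    removed-cost w Xw with V w | w ≟ u | ε u w
    ... | true | yes _ | _     = s≤s z≤n
    ... | true | no  _ | suc _ = s≤s z≤n

    cardV*d≤arcs : card V * d ≤ arcs V
    cardV*d≤arcs = subst (_≤ arcs V) (∑⟨⟩-const V d) (∑⟨⟩-mono V minimal)

    1≤cardX : 1 ≤ card X
    1≤cardX = begin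
      1                                   ≡⟨ cong 𝟙 Xu ⟨
      𝟙 (X u)                              ≡⟨ ∑⟨⟩-δ X u ⟨
      ∑⟨ X ⟩ (λ w → 𝟙 (does (w ≟ u)))      ≤⟨ ∑⟨⟩-mono X (λ w _ → 𝟙≤1 (does (w ≟ u))) ⟩
      card X                              ∎
      where
      open ≤-Reasoning
      Xu : X u ≡ true
      Xu rewrite Vu | dec-true (u ≟ u) refl = refl

    cardX≤1+d : card X ≤ suc d
    cardX≤1+d = begin
      card X                                          ≤⟨ ∑⟨⟩-mono X removed-cost ⟩
      ∑⟨ X ⟩ (λ w → 𝟙 (does (w ≟ u)) + ε u w)          ≤⟨ ∑⟨⟩-⊆ _ X⊆V ⟩
      ∑⟨ V ⟩ (λ w → 𝟙 (does (w ≟ u)) + ε u w)          ≡⟨ ∑⟨⟩-distrib-+ V _ (ε u) ⟩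
      ∑⟨ V ⟩ (λ w → 𝟙 (does (w ≟ u))) + d              ≡⟨ cong (_+ d) (trans (∑⟨⟩-δ V u) (cong 𝟙 Vu)) ⟩
      suc d                                          ∎
      where open ≤-Reasoning

    arcs′+cardX*d≤arcs : arcs V′ + card X * d ≤ arcs V
    arcs′+cardX*d≤arcs = begin
      arcs V′ + card X * d                         ≤⟨ +-mono-≤ (∑⟨⟩-mono V′ (λ w _ → ∑⟨⟩-⊆ (ε w) V′⊆V)) cardX*d≤ ⟩
      ∑⟨ V′ ⟩ (outdeg V) + ∑⟨ X ⟩ (outdeg V)         ≡⟨ ∑⟨⟩-split V survives (outdeg V) ⟨
      arcs V                                       ∎
      where
      open ≤-Reasoning
      cardX*d≤ : card X * d ≤ ∑⟨ X ⟩ (outdeg V)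
      cardX*d≤ = subst (_≤ ∑⟨ X ⟩ (outdeg V)) (∑⟨⟩-const X d) (∑⟨⟩-mono X (λ w Xw → minimal w (X⊆V w Xw)))

    cardV′<cardV : card V′ < card V
    cardV′<cardV = begin-strict
      card V′           <⟨ m<m+n (card V′) 1≤cardX ⟩
      card V′ + card X  ≡⟨ card-split ⟨
      card V            ∎
      where open ≤-Reasoning

    extend : IndependentList V′ → IndependentList V
    extend I = record
      { vertices    = u ∷ vertices
      ; ⊆V          = Vu ∷ All.map (V′⊆V _) ⊆V
      ; independent = All.map (survivor-independent _) ⊆V ∷ independent
      ; turán       = subst (λ N → N * N ≤ suc (length vertices) * (N + arcs V)) (sym card-split)
                        (turán-invariant (length vertices) cardX≤1+d
                           (subst (λ N → N * d ≤ arcs V) card-split cardV*d≤arcs) arcs′+cardX*d≤arcs turán)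
      }
      where
      open IndependentList I

  greedyIndependent : ∀ V → IndependentList V
  greedyIndependent V = go V (<-wellFounded (card V))
    where
    go : ∀ V → Acc _<_ (card V) → IndependentList V
    go V (acc rec) with any? (λ v → V v Bool.≟ true)
    ... | yes (v , Vv) = let (u , Vu , minimal) = argmin-on (outdeg V) V Vv
                             open GreedyStep V u Vu minimal
                         in extend (go V′ (rec cardV′<cardV))
    ... | no  none     = record { vertices = [] ; ⊆V = [] ; independent = [] ; turán = N²≤0 }
      where
      card≡0 : card V ≡ 0
      card≡0 = sum-zero pointwise
        where
        pointwise : ∀ u → 𝟙 (V u) * 1 ≡ 0
        pointwise u with V u in Vu
        ... | true  = contradiction (u , Vu) none
        ... | false = refl
      N²≤0 : card V * card V ≤ 0
      N²≤0 = subst (λ N → N * N ≤ 0) (sym card≡0) z≤n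

-- Cells and forcing lists

Cell : ℕ → Set
Cell n = Fin n × Fin n

_≟ᶜ_ : ∀ {n} → DecidableEquality (Cell n)
_≟ᶜ_ = ≡-dec _≟_ _≟_

_∈?_ : ∀ {n} (c : Cell n) (xs : List (Cell n)) → Dec (c ∈ xs)
c ∈? xs = DecMembership._∈?_ _≟ᶜ_ c xs

∑∑ : ∀ {n} → (Cell n → ℕ) → ℕ
∑∑ {n} f = ∑[ i < n ] ∑[ j < n ] f (i , j)

∑∑-cong : ∀ {n} {f g : Cell n → ℕ} → (∀ c → f c ≡ g c) → ∑∑ f ≡ ∑∑ g
∑∑-cong f≗g = sum-cong-≗ (λ i → sum-cong-≗ (λ j → f≗g (i , j)))

∑∑-mono-≤ : ∀ {n} {f g : Cell n → ℕ} → (∀ c → f c ≤ g c) → ∑∑ f ≤ ∑∑ g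
∑∑-mono-≤ f≤g = sum-mono-≤ (λ i → sum-mono-≤ (λ j → f≤g (i , j)))

∑∑-distrib-+ : ∀ {n} (f g : Cell n → ℕ) → ∑∑ (λ c → f c + g c) ≡ ∑∑ f + ∑∑ g
∑∑-distrib-+ {n} f g = trans (sum-cong-≗ (λ i → ∑-distrib-+ (λ j → f (i , j)) (λ j → g (i , j))))
  (∑-distrib-+ (λ i → ∑[ j < n ] f (i , j)) (λ i → ∑[ j < n ] g (i , j)))

∑∑-single : ∀ {n} {f : Cell n → ℕ} p → (∀ c → c ≢ p → f c ≡ 0) → ∑∑ f ≡ f p
∑∑-single {f = f} (p , q) f≡0 = trans
  (sum-single p (λ i i≢p → sum-zero (λ j → f≡0 (i , j) (i≢p ∘ cong proj₁))))
  (sum-single q (λ j j≢q → f≡0 (p , j) (j≢q ∘ cong proj₂)))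

∑∑-δ : ∀ {n} (p : Cell n) → ∑∑ (λ c → 𝟙 (does (c ≟ᶜ p))) ≡ 1
∑∑-δ p = trans (∑∑-single p (λ c c≢p → cong 𝟙 (dec-false (c ≟ᶜ p) c≢p))) (cong 𝟙 (dec-true (p ≟ᶜ p) refl))

𝟙-∈?-∷ : ∀ {n} (c x : Cell n) {xs} → x ∉ xs →
         𝟙 (does (c ∈? (x ∷ xs))) ≡ 𝟙 (does (c ≟ᶜ x)) + 𝟙 (does (c ∈? xs))
𝟙-∈?-∷ c x {xs} x∉xs with c ≟ᶜ x
... | yes refl = cong (λ b → 1 + 𝟙 b) (sym (dec-false (c ∈? xs) x∉xs))
... | no  _    = refl

∑∑-∈ : ∀ {n} {xs : List (Cell n)} → Unique xs → ∑∑ (λ c → 𝟙 (does (c ∈? xs))) ≡ length xs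
∑∑-∈ {n} [] = sum-zero {n} (λ i → sum-zero {n} (λ j → refl))
∑∑-∈ {xs = x ∷ xs} (x≢xs ∷ unique) = begin
  ∑∑ (λ c → 𝟙 (does (c ∈? (x ∷ xs))))                        ≡⟨ ∑∑-cong (λ c → 𝟙-∈?-∷ c x (All.All¬⇒¬Any x≢xs)) ⟩
  ∑∑ (λ c → 𝟙 (does (c ≟ᶜ x)) + 𝟙 (does (c ∈? xs)))          ≡⟨ ∑∑-distrib-+ (λ c → 𝟙 (does (c ≟ᶜ x))) _ ⟩
  ∑∑ (λ c → 𝟙 (does (c ≟ᶜ x))) + ∑∑ (λ c → 𝟙 (does (c ∈? xs))) ≡⟨ cong₂ _+_ (∑∑-δ x) (∑∑-∈ unique) ⟩
  suc (length xs)                                            ∎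
  where open ≡-Reasoning

module _ {n : ℕ} {L : Square n} (latin : IsLatin L) where

  colOf : Fin n → Fin n → Fin n
  colOf i k = proj₁ (proj₁ latin i k)

  rowOf : Fin n → Fin n → Fin n
  rowOf j k = proj₁ (proj₂ latin j k)

  L[i,colOf] : ∀ i k → L i (colOf i k) ≡ k
  L[i,colOf] i k = proj₁ (proj₂ (proj₁ latin i k))

  L[rowOf,j] : ∀ j k → L (rowOf j k) j ≡ k
  L[rowOf,j] j k = proj₁ (proj₂ (proj₂ latin j k))

  row-injective : ∀ i {c c′} → L i c ≡ L i c′ → c ≡ c′
  row-injective i {c} {c′} eq = trans (unique c eq) (sym (unique c′ refl))
    where unique = proj₂ (proj₂ (proj₁ latin i (L i c′)))

  col-injective : ∀ j {r r′} → L r j ≡ L r′ j → r ≡ r′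
  col-injective j {r} {r′} eq = trans (unique r eq) (sym (unique r′ refl))
    where unique = proj₂ (proj₂ (proj₂ latin j (L r′ j)))

  colOf-≡ : ∀ {i c k} → L i c ≡ k → colOf i k ≡ c
  colOf-≡ {i} Lic≡k = row-injective i (trans (L[i,colOf] i _) (sym Lic≡k))

  colOf-injective : ∀ i {k k′} → colOf i k ≡ colOf i k′ → k ≡ k′
  colOf-injective i {k} {k′} eq = trans (sym (L[i,colOf] i k)) (trans (cong (L i) eq) (L[i,colOf] i k′))

  L[i,c]≡k : ∀ {i c k} → colOf i k ≡ c → L i c ≡ k
  L[i,c]≡k {i} {k = k} refl = L[i,colOf] i k

  L[r,j]≡k : ∀ {j r k} → rowOf j k ≡ r → L r j ≡ k
  L[r,j]≡k {j} {k = k} refl = L[rowOf,j] j k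

complement : ∀ {n} → List (Cell n) → SubOf n
complement S i j = not (does ((i , j) ∈? S))

size-complement : ∀ {n} {S : List (Cell n)} → Unique S → size (complement S) + length S ≡ n * n
size-complement {n} {S} unique = begin
  size (complement S) + length S
    ≡⟨ cong₂ _+_ (size≡∑ (complement S)) (sym (∑∑-∈ unique)) ⟩
  ∑∑ (λ c → 𝟙 (not (does (c ∈? S)))) + ∑∑ (λ c → 𝟙 (does (c ∈? S)))
    ≡⟨ ∑∑-distrib-+ {n} _ _ ⟨
  ∑∑ (λ c → 𝟙 (not (does (c ∈? S))) + 𝟙 (does (c ∈? S)))
    ≡⟨ ∑∑-cong (λ c → 𝟙-not+𝟙 (does (c ∈? S))) ⟩
  ∑∑ {n} (λ _ → 1)
    ≡⟨ sum-cong-≗ {n} (λ i → trans (sum-const n 1) (*-identityʳ n)) ⟩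
  ∑[ i < n ] n
    ≡⟨ sum-const n n ⟩
  n * n ∎
  where
  open ≡-Reasoning
  𝟙-not+𝟙 : ∀ b → 𝟙 (not b) + 𝟙 b ≡ 1
  𝟙-not+𝟙 true  = refl
  𝟙-not+𝟙 false = refl

module _ {n : ℕ} (L : Square n) where

  NoConflict : Cell n → List (Cell n) → Set
  NoConflict (i , j) xs = ∀ {c r} → (i , c) ∈ xs → (r , j) ∈ xs → L i c ≢ L r j

  data Forcing : List (Cell n) → Set where
    []  : Forcing []
    _∷_ : ∀ {x xs} → NoConflict x xs → Forcing xs → Forcing (x ∷ xs)

  AgreesOutside : List (Cell n) → Square n → Set
  AgreesOutside S L′ = ∀ i j → (i , j) ∉ S → L′ i j ≡ L i j

Forcing⇒Unique : ∀ {n} {L : Square n} {S} → Forcing L S → Unique S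
Forcing⇒Unique []                        = []
Forcing⇒Unique {S = (_ , _) ∷ _} (nc ∷ F) = All.¬Any⇒All¬ _ (λ x∈xs → nc x∈xs x∈xs refl) ∷ Forcing⇒Unique F

module _ {n : ℕ} {L L′ : Square n} (latin : IsLatin L) (latin′ : IsLatin L′) where

  symbol-in-row : ∀ {i j xs} → AgreesOutside L ((i , j) ∷ xs) L′ →
                  (i , colOf latin i (L′ i j)) ∈ xs ⊎ L i j ≡ L′ i j
  symbol-in-row {i} {j} {xs} agree with (i , colOf latin i (L′ i j)) ∈? ((i , j) ∷ xs)
  ... | yes (there ic∈xs) = inj₁ ic∈xs
  ... | yes (here ic≡ij)  = inj₂ (L[i,c]≡k latin (cong proj₂ ic≡ij))
  ... | no  ic∉           = inj₂ (L[i,c]≡k latin (row-injective latin′ i (trans (agree i _ ic∉) (L[i,colOf] latin i _))))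

  symbol-in-col : ∀ {i j xs} → AgreesOutside L ((i , j) ∷ xs) L′ →
                  (rowOf latin j (L′ i j) , j) ∈ xs ⊎ L i j ≡ L′ i j
  symbol-in-col {i} {j} {xs} agree with (rowOf latin j (L′ i j) , j) ∈? ((i , j) ∷ xs)
  ... | yes (there rj∈xs) = inj₁ rj∈xs
  ... | yes (here rj≡ij)  = inj₂ (L[r,j]≡k latin (cong proj₁ rj≡ij))
  ... | no  rj∉           = inj₂ (L[r,j]≡k latin (col-injective latin′ j (trans (agree _ j rj∉) (L[rowOf,j] latin j _))))

  forced : ∀ {i j xs} → NoConflict L (i , j) xs → AgreesOutside L ((i , j) ∷ xs) L′ → L′ i j ≡ L i j
  forced {i} {j} nc agree with symbol-in-row agree | symbol-in-col agree
  ... | inj₂ Lij≡k | _          = sym Lij≡k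
  ... | inj₁ _     | inj₂ Lij≡k = sym Lij≡k
  ... | inj₁ ic∈xs | inj₁ rj∈xs =
    contradiction (trans (L[i,colOf] latin i (L′ i j)) (sym (L[rowOf,j] latin j (L′ i j)))) (nc ic∈xs rj∈xs)

  agrees-everywhere : ∀ {S} → Forcing L S → AgreesOutside L S L′ → ∀ i j → L′ i j ≡ L i j
  agrees-everywhere []                        agree i j = agree i j λ ()
  agrees-everywhere {(p , q) ∷ xs} (nc ∷ F) agree     = agrees-everywhere F agree′
    where
    agree′ : AgreesOutside L xs L′
    agree′ i j ij∉xs with (i , j) ≟ᶜ (p , q)
    ... | yes refl = forced nc agree
    ... | no  ij≢pq = agree i j λ { (here ij≡pq) → ij≢pq ij≡pq ; (there ij∈xs) → ij∉xs ij∈xs }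

forcing⇒uniquelyCompletable : ∀ {n} {L : Square n} {S} → IsLatin L → Forcing L S →
                              UniquelyCompletable L (complement S)
forcing⇒uniquelyCompletable {S = S} latin F L′ latin′ agree =
  agrees-everywhere latin latin′ F (λ i j ij∉S → agree i j (cong not (dec-false ((i , j) ∈? S) ij∉S)))

-- Building a long forcing list row by row

module _ {n : ℕ} {L : Square n} (latin : IsLatin L) where

  arc : Fin n → Cell n → Cell n
  arc i (r , q) = q , colOf latin i (L r q)

  arc-injective : ∀ i {x y} → arc i x ≡ arc i y → x ≡ y
  arc-injective i {r , q} {r′ , q′} eq with cong proj₁ eq
  ... | refl = cong (_, q) (col-injective latin q (colOf-injective latin i (cong proj₂ eq)))

  -- An arc v → w says that a cell of S in column v carries the symbol L i w, so that
  -- (i , v) would conflict with a later (i , w).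
  conflicts : Fin n → List (Cell n) → Fin n → Fin n → ℕ
  conflicts i S v w = 𝟙 (does ((v , w) ∈? map (arc i) S))

  module _ (i : Fin n) {S : List (Cell n)} where
    open Digraph (conflicts i S) using (card; arcs; Independent)

    card-all : card (const true) ≡ n
    card-all = trans (sum-const n 1) (*-identityʳ n)

    arcs-all : Unique S → arcs (const true) ≡ length S
    arcs-all unique = begin
      arcs (const true)                         ≡⟨ sum-cong-≗ {n} (λ v → trans (*-identityˡ _) (sum-cong-≗ {n} (λ w → *-identityˡ _))) ⟩
      ∑∑ (λ c → 𝟙 (does (c ∈? map (arc i) S)))  ≡⟨ ∑∑-∈ (Unique.map⁺ (arc-injective i) unique) ⟩
      length (map (arc i) S)                    ≡⟨ length-map (arc i) S ⟩
      length S                                  ∎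
      where open ≡-Reasoning

    ∈-row-++⁻ : ∀ {J x} → x ∈ map (i ,_) J ++ S → (proj₁ x ≡ i × proj₂ x ∈ J) ⊎ x ∈ S
    ∈-row-++⁻ {J} x∈ with ∈-++⁻ (map (i ,_) J) x∈
    ... | inj₂ x∈S   = inj₂ x∈S
    ... | inj₁ x∈row with ∈-map⁻ (i ,_) x∈row
    ...   | j , j∈J , refl = inj₁ (refl , j∈J)

    forcing-++ : Forcing L S → All (λ x → proj₁ x ≢ i) S → ∀ {J} → Independent J → Forcing L (map (i ,_) J ++ S)
    forcing-++ F _ []                      = F
    forcing-++ F fresh {v ∷ J} (v↛J ∷ ind) = no-conflict ∷ forcing-++ F fresh ind
      where
      no-conflict : NoConflict L (i , v) (map (i ,_) J ++ S)
      no-conflict {c} {r} ic∈ rv∈ Lic≡Lrv with ∈-row-++⁻ ic∈ | ∈-row-++⁻ rv∈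
      ... | inj₂ ic∈S      | _                = All.lookup fresh ic∈S refl
      ... | inj₁ (_ , c∈J) | inj₁ (refl , v∈J) = proj₁ (All.lookup v↛J v∈J) refl
      ... | inj₁ (_ , c∈J) | inj₂ rv∈S         = 1+n≢0 (trans (sym (cong 𝟙 (dec-true (_ ∈? _) vc∈arcs))) no-arc)
        where
        no-arc : conflicts i S v c ≡ 0
        no-arc = proj₂ (All.lookup v↛J c∈J)
        vc∈arcs : (v , c) ∈ map (arc i) S
        vc∈arcs = subst (_∈ map (arc i) S) (cong (v ,_) (colOf-≡ latin Lic≡Lrv)) (∈-map⁺ (arc i) rv∈S)

    extendRow : Forcing L S → All (λ x → proj₁ x ≢ i) S →
                Σ (List (Fin n)) λ J → Forcing L (map (i ,_) J ++ S) × n * n ≤ length J * (n + length S)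
    extendRow F fresh = vertices , forcing-++ F fresh independent , bound
      where
      open Digraph.IndependentList (Digraph.greedyIndependent (conflicts i S) (const true))
      bound : n * n ≤ length vertices * (n + length S)
      bound = subst₂ (λ N E → N * N ≤ length vertices * (N + E)) card-all (arcs-all (Forcing⇒Unique F)) turán

    potential-++ : ∀ {J} → n * n ≤ length J * (n + length S) →
                   potential n (length S) + 2 * (n * n) ≤ potential n (length (map (i ,_) J ++ S))
    potential-++ {J} turán = subst (λ m → potential n (length S) + 2 * (n * n) ≤ potential n m) (sym length-J++S)
                                   (growth-step {n} {length S} {length J} turán)
      where
      length-J++S : length (map (i ,_) J ++ S) ≡ length S + length J
      length-J++S = trans (length-++ (map (i ,_) J)) (trans (cong (_+ length S) (length-map (i ,_) J)) (+-comm (length J) (length S)))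

  fresh-++ : ∀ {i : Fin n} {rs J} {S : List (Cell n)} → i ∉ rs → All (λ x → proj₁ x ∉ i ∷ rs) S →
             All (λ x → proj₁ x ∉ rs) (map (i ,_) J ++ S)
  fresh-++ i∉rs fresh = All.++⁺ (All.map⁺ (All.tabulate λ _ → i∉rs)) (All.map (_∘ there) fresh)

  allRows : ∀ {rs} → Unique rs → ∀ {S} → Forcing L S → All (λ x → proj₁ x ∉ rs) S →
            Σ (List (Cell n)) λ S′ → Forcing L S′ ×
              potential n (length S) + length rs * (2 * (n * n)) ≤ potential n (length S′)
  allRows [] {S} F _ = S , F , ≤-reflexive (+-identityʳ _)
  allRows {i ∷ rs} (i∉rs ∷ unique) {S} F fresh with extendRow i F (All.map (_∘ here) fresh)
  ... | J , F₁ , turán with allRows unique F₁ (fresh-++ (All.All¬⇒¬Any i∉rs) fresh)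
  ... | S′ , F′ , grown = S′ , F′ , (begin
    potential n (length S) + (2n² + length rs * 2n²)          ≡⟨ +-assoc (potential n (length S)) 2n² (length rs * 2n²) ⟨
    potential n (length S) + 2n² + length rs * 2n²            ≤⟨ +-monoˡ-≤ (length rs * 2n²) (potential-++ i {S} {J} turán) ⟩
    potential n (length (map (i ,_) J ++ S)) + length rs * 2n² ≤⟨ grown ⟩
    potential n (length S′)                                   ∎)
    where
    open ≤-Reasoning
    2n² = 2 * (n * n)

largeForcingList : ∀ {n} {L : Square n} → IsLatin L →
                   Σ (List (Cell n)) λ S → Forcing L S × n * (2 * (n * n)) ≤ potential n (length S)
largeForcingList {n} latin with allRows latin (Unique.allFin⁺ n) [] []
... | S , forcing , grown = S , forcing , ≤-trans (m≤n+m (n * (2 * (n * n))) (potential n 0))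
  (subst (λ k → potential n 0 + k * (2 * (n * n)) ≤ potential n (length S)) (length-tabulate {n = n} id) grown)

-- Critical subsets

_⊆_ : ∀ {n} → SubOf n → SubOf n → Set
C ⊆ D = ∀ i j → C i j ≡ true → D i j ≡ true

size-mono : ∀ {n} {C D : SubOf n} → C ⊆ D → size C ≤ size D
size-mono {C = C} {D} C⊆D = subst₂ _≤_ (sym (size≡∑ C)) (sym (size≡∑ D)) (∑∑-mono-≤ pointwise)
  where
  pointwise : ∀ c → 𝟙 (uncurry C c) ≤ 𝟙 (uncurry D c)
  pointwise (i , j) with C i j in Cij
  ... | true  rewrite C⊆D i j Cij = ≤-refl
  ... | false = z≤n

size+length≤n² : ∀ {n} {S : List (Cell n)} {C} → Unique S → C ⊆ complement S → size C + length S ≤ n * n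
size+length≤n² {C = C} unique C⊆ = ≤-trans (+-monoˡ-≤ _ (size-mono {C = C} C⊆)) (≤-reflexive (size-complement unique))

uniquelyCompletable-mono : ∀ {n} {L : Square n} {C D} → C ⊆ D → UniquelyCompletable L C → UniquelyCompletable L D
uniquelyCompletable-mono C⊆D UC L′ latin′ agree = UC L′ latin′ (λ i j Cij → agree i j (C⊆D i j Cij))

remove : ∀ {n} → SubOf n → Cell n → SubOf n
remove C x i j = C i j ∧ not (does ((i , j) ≟ᶜ x))

remove-⊆ : ∀ {n} (C : SubOf n) x → remove C x ⊆ C
remove-⊆ C x i j with C i j
... | true = λ _ → refl

remove-mono : ∀ {n} {C D : SubOf n} x → C ⊆ D → remove C x ⊆ remove D x
remove-mono {C = C} {D} x C⊆D i j with C i j in Cij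
... | true rewrite C⊆D i j Cij = id

remove-self : ∀ {n} (C : SubOf n) i j → remove C (i , j) i j ≡ false
remove-self C i j rewrite dec-true ((i , j) ≟ᶜ (i , j)) refl with C i j
... | true  = refl
... | false = refl

⊆-remove : ∀ {n} {C′ C : SubOf n} {i j} → C′ ⊆ C → C′ i j ≡ false → C′ ⊆ remove C (i , j)
⊆-remove {i = i} {j} C′⊆C C′ij≡false a b C′ab with (a , b) ≟ᶜ (i , j)
... | yes refl = contradiction (trans (sym C′ab) C′ij≡false) λ ()
... | no  _    rewrite C′⊆C a b C′ab = refl

module _ {n : ℕ} {P : SubOf n → Set} (P? : Decidable P) (P-mono : ∀ {C D} → C ⊆ D → P C → P D) where

  pruneStep : SubOf n → Cell n → SubOf n
  pruneStep C x = if does (P? (remove C x)) then remove C x else C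

  -- A single pass suffices: P is upward closed, so a cell that could not be deleted when it
  -- was visited cannot be deleted from the smaller final set either.
  prune : List (Cell n) → SubOf n → SubOf n
  prune []       C = C
  prune (x ∷ xs) C = prune xs (pruneStep C x)

  prune-⊆ : ∀ xs C → prune xs C ⊆ C
  prune-⊆ []       C i j = id
  prune-⊆ (x ∷ xs) C with P? (remove C x)
  ... | yes _ = λ i j → remove-⊆ C x i j ∘ prune-⊆ xs (remove C x) i j
  ... | no  _ = prune-⊆ xs C

  prune-P : ∀ xs {C} → P C → P (prune xs C)
  prune-P []       PC = PC
  prune-P (x ∷ xs) {C} PC with P? (remove C x)
  ... | yes P[C-x] = prune-P xs P[C-x]
  ... | no  _      = prune-P xs PC

  prune-minimal : ∀ {xs} C {i j} → (i , j) ∈ xs → prune xs C i j ≡ true → ¬ P (remove (prune xs C) (i , j))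
  prune-minimal {y ∷ xs} C (there ij∈xs) = prune-minimal (pruneStep C y) ij∈xs
  prune-minimal {y ∷ xs} C {i} {j} (here refl) kept P[C′-ij] with P? (remove C (i , j))
  ... | yes _ = contradiction (trans (sym (prune-⊆ xs _ i j kept)) (remove-self C i j)) λ ()
  ... | no ¬P[C-ij] = ¬P[C-ij] (P-mono (remove-mono (i , j) (prune-⊆ xs C)) P[C′-ij])

  minimal-⊆ : ∀ {C} → P C → Σ (SubOf n) λ C′ → C′ ⊆ C × P C′ × (∀ C″ → ProperSub C″ C′ → ¬ P C″)
  minimal-⊆ {C} PC = prune cells C , prune-⊆ cells C , prune-P cells PC , minimal
    where
    cells = cartesianProduct (allFin n) (allFin n)
    minimal : ∀ C″ → ProperSub C″ (prune cells C) → ¬ P C″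
    minimal C″ (C″⊆ , i , j , kept , C″ij≡false) P[C″] =
      prune-minimal C (∈-cartesianProduct⁺ (∈-allFin i) (∈-allFin j)) kept (P-mono (⊆-remove C″⊆ C″ij≡false) P[C″])

-- Deciding unique completability

Searchable : Set → Set₁
Searchable A = ∀ {P : A → Set} → Decidable P → Dec (∀ a → P a)

searchable-Vec : ∀ {A} → Searchable A → ∀ k → Searchable (Vec A k)
searchable-Vec search zero    P? = map′ (λ P[] → λ { [] → P[] }) (λ ∀P → ∀P []) (P? [])
searchable-Vec search (suc k) P? =
  map′ (λ ∀P → λ { (a ∷ v) → ∀P a v }) (λ ∀P a v → ∀P (a ∷ v))
       (search λ a → searchable-Vec search k (P? ∘ (a ∷_)))

_≗²_ : ∀ {n} → Square n → Square n → Set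
L ≗² L′ = ∀ i j → L i j ≡ L′ i j

-- Q must respect pointwise equality, since toSquare (fromSquare L) is only pointwise equal to L.
∀-Square? : ∀ {n} {Q : Square n → Set} → (∀ {L L′} → L ≗² L′ → Q L → Q L′) → Decidable Q → Dec (∀ L → Q L)
∀-Square? {n} Q-resp Q? =
  map′ (λ ∀Q L → Q-resp (toSquare∘fromSquare L) (∀Q (fromSquare L))) (λ ∀Q → ∀Q ∘ toSquare)
       (searchable-Vec (searchable-Vec all? n) n (Q? ∘ toSquare))
  where
  toSquare : Vec (Vec (Fin n) n) n → Square n
  toSquare rows i j = lookup (lookup rows i) j
  fromSquare : Square n → Vec (Vec (Fin n) n) n
  fromSquare L = Vec.tabulate (Vec.tabulate ∘ L)
  toSquare∘fromSquare : ∀ L → toSquare (fromSquare L) ≗² L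
  toSquare∘fromSquare L i j =
    trans (cong (λ row → lookup row j) (lookup∘tabulate (Vec.tabulate ∘ L) i)) (lookup∘tabulate (L i) j)

isLatin? : ∀ {n} → Decidable (IsLatin {n})
isLatin? L = all? (λ i → all? (λ k → any? (λ j → (L i j ≟ k) ×-dec all? (λ j′ → (L i j′ ≟ k) →-dec (j′ ≟ j)))))
      ×-dec all? (λ j → all? (λ k → any? (λ i → (L i j ≟ k) ×-dec all? (λ i′ → (L i′ j ≟ k) →-dec (i′ ≟ i)))))

IsLatin-resp : ∀ {n} {L L′ : Square n} → L ≗² L′ → IsLatin L → IsLatin L′
IsLatin-resp L≗L′ (rows , cols) =
  (λ i k → let j , Lij≡k , unique = rows i k
           in j , trans (sym (L≗L′ i j)) Lij≡k , λ j′ → unique j′ ∘ trans (L≗L′ i j′)) ,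
  (λ j k → let i , Lij≡k , unique = cols j k
           in i , trans (sym (L≗L′ i j)) Lij≡k , λ i′ → unique i′ ∘ trans (L≗L′ i′ j))

uniquelyCompletable? : ∀ {n} (L : Square n) → Decidable (UniquelyCompletable L)
uniquelyCompletable? {n} L C = ∀-Square? completes-resp completes?
  where
  Completes : Square n → Set
  Completes L′ = IsLatin L′ → ((i j : Fin n) → C i j ≡ true → L′ i j ≡ L i j) → (i j : Fin n) → L′ i j ≡ L i j
  completes? : Decidable Completes
  completes? L′ = isLatin? L′ →-dec (all? (λ i → all? (λ j → (C i j Bool.≟ true) →-dec (L′ i j ≟ L i j)))
                                  →-dec all? (λ i → all? (λ j → L′ i j ≟ L i j)))
  completes-resp : ∀ {L₁ L₂} → L₁ ≗² L₂ → Completes L₁ → Completes L₂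
  completes-resp L₁≗L₂ completes₁ latin₂ agree₂ i j = trans (sym (L₁≗L₂ i j))
    (completes₁ (IsLatin-resp (λ a b → sym (L₁≗L₂ a b)) latin₂)
                (λ a b Cab → trans (L₁≗L₂ a b) (agree₂ a b Cab)) i j)

theorem1 : (n : ℕ) → 0 < n → (L : Square n) → IsLatin L →
    Σ (SubOf n) (λ C → IsCritical L C × SmallSize n (size C))
theorem1 n 0<n L latin with largeForcingList latin
... | S , forcing , grown
  with minimal-⊆ (uniquelyCompletable? L) uniquelyCompletable-mono (forcing⇒uniquelyCompletable latin forcing)
... | C , C⊆ , UC , minimal =
  C , (UC , minimal) , smallSize {n} (13n³<15m² n 0<n grown) (size+length≤n² (Forcing⇒Unique forcing) C⊆)
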